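{- Let $H$ be an atomic monoid and let $a\in H$. (1) Let $x,y\in\mathsf Z(a)$ with $\min\{|x|,|y|\}>\mathsf c_{\mathrm{mon}}(a)$. Then there is a monotone $\mathcal R$-chain concatenating $x$ and $y$, and thus $x\approx y$; in particular, if $|x|=|y|$, then $x\approx_{\mathrm{eq}}y$. (2) Let $k,l\in\mathsf L(a)$. Then $\mathsf d(\mathsf Z_k(a),\mathsf Z_l(a))=\max\{k,l\}$ if and only if $\gcd(x,y)=1$ for all $x\in\mathsf Z_k(a)$ and $y\in\mathsf Z_l(a)$. (3) Let $k,l\in\mathsf L(a)$ be adjacent with $k<l$ such that there are $x\in\mathsf Z_k(a)$ and $y\in\mathsf Z_l(a)$ for which there is a monotone $\mathcal R$-chain concatenating $x$ and $y$. Then $\mu_{\mathrm{adj}}(a)\neq l$.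
   Context: A monoid is a commutative, cancellative semigroup with identity; $H^\times$ its unit group, $H_{\mathrm{red}}=H/H^\times$; $H$ is atomic if every non-unit is a product of atoms. $\mathsf Z(H)$ is the free abelian monoid on the atoms of $H_{\mathrm{red}}$, $\pi_H:\mathsf Z(H)\to H_{\mathrm{red}}$ the homomorphism that is the identity on atoms; $\mathsf Z(a)=\pi_H^{ -1}(aH^\times)$, $\mathsf L(a)=\{|z|:z\in\mathsf Z(a)\}$, $\mathsf Z_k(a)=\{z\in\mathsf Z(a):|z|=k\}$. $\mathsf d(z,z')=\max\{|z/\gcd(z,z')|,|z'/\gcd(z,z')|\}$ and $\mathsf d(X,Y)=\min\{\mathsf d(x,y):x\in X,y\in Y\}$. Lengths $k<l$ in $\mathsf L(a)$ are adjacent if $[k,l]\cap\mathsf L(a)=\{k,l\}$. The supremum of the empty set is $0$. For $N\in\mathbb N$, a monotone $N$-chain concatenating $z_0$ and $z_n$ is a sequence $z_0,\dots,z_n\in\mathsf Z(a)$ ($n\in\mathbb N$) with $\mathsf d(z_{i-1},z_i)\le N$ and $|z_{i-1}|\le|z_i|$ for all $i\in[1,n]$; $\mathsf c_{\mathrm{mon}}(a)$ is the smallest $N\in\mathbb N_0\cup\{\infty\}$ such that any two $z,z'\in\mathsf Z(a)$ can be concatenated by a monotone $N$-chain. An $\mathcal R$-chain is a sequence $z_0,\dots,z_n\in\mathsf Z(a)$ ($n\in\mathbb N$) with $\gcd(z_{i-1},z_i)\ne1$ for all $i$; it is monotone if $|z_{i-1}|\le|z_i|$ for all $i$ and equal-length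 if $|z_{i-1}|=|z_i|$ for all $i$. $z\approx z'$ (resp. $z\approx_{\mathrm{eq}}z'$) if there is an $\mathcal R$-chain (resp. equal-length $\mathcal R$-chain) concatenating $z$ and $z'$. $\mu_{\mathrm{adj}}(a)=\sup\{k\in\mathsf L(a):\text{there is }l\in\mathsf L(a),\ l<k,\ l\text{ adjacent to }k,\text{ with }\mathsf d(\mathsf Z_k(a),\mathsf Z_l(a))=k\}$. -}

module Defs where

open import Level using (Level; _⊔_)
open import Algebra.Bundles using (CommutativeMonoid)
open import Data.Nat using (ℕ; _≤_; _<_; _∸_) renaming (_⊔_ to _⊔ℕ_)
open import Data.List using (List; []; _∷_; _++_; length; foldr)
open import Data.Product using (Σ; ∃; ∃-syntax; _×_; _,_; proj₁)
open import Data.Sum using (_⊎_)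
open import Relation.Nullary using (¬_)
open import Data.Empty using (⊥)
open import Relation.Binary.PropositionalEquality using (_≡_)
open import Relation.Binary.Bundles using (Setoid)
open import Relation.Binary.Structures using (IsEquivalence)
import Relation.Binary.Reasoning.Setoid as SetoidReasoning
import Data.List.Relation.Binary.Permutation.Setoid as PermSetoid

module Fact {c ℓ : Level} (H : CommutativeMonoid c ℓ) where
  open CommutativeMonoid H

  Cancellative : Set (c ⊔ ℓ)
  Cancellative = ∀ x y z → x ∙ y ≈ x ∙ z → y ≈ z

  IsUnit : Carrier → Set (c ⊔ ℓ)
  IsUnit u = ∃[ v ] (u ∙ v ≈ ε)

  -- associated elements: equal in H_red = H / H^×
  _≃_ : Carrier → Carrier → Set (c ⊔ ℓ)
  x ≃ y = ∃[ u ] (IsUnit u × x ≈ u ∙ y)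

  IsAtom : Carrier → Set (c ⊔ ℓ)
  IsAtom x = ¬ IsUnit x × (∀ y z → x ≈ y ∙ z → IsUnit y ⊎ IsUnit z)

  Atom : Set (c ⊔ ℓ)
  Atom = Σ Carrier IsAtom

  ≃-refl : ∀ {x} → x ≃ x
  ≃-refl {x} = ε , (ε , identityˡ ε) , sym (identityˡ x)

  ≃-sym : ∀ {x y} → x ≃ y → y ≃ x
  ≃-sym {x} {y} (u , (v , uv) , x≈uy) = v , (u , trans (comm v u) uv) , eq
    where
    open SetoidReasoning setoid
    eq : y ≈ v ∙ x
    eq = begin
      y             ≈⟨ sym (identityˡ y) ⟩
      ε ∙ y         ≈⟨ ∙-congʳ (sym (trans (comm v u) uv)) ⟩
      (v ∙ u) ∙ y   ≈⟨ assoc v u y ⟩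
      v ∙ (u ∙ y)   ≈⟨ ∙-congˡ (sym x≈uy) ⟩
      v ∙ x         ∎

  ≃-trans : ∀ {x y z} → x ≃ y → y ≃ z → x ≃ z
  ≃-trans {x} {y} {z} (u , (v , uv) , x≈uy) (u' , (v' , uv') , y≈u'z) =
    u ∙ u' , (v ∙ v' , unit) , eq
    where
    open SetoidReasoning setoid
    unit : (u ∙ u') ∙ (v ∙ v') ≈ ε
    unit = begin
      (u ∙ u') ∙ (v ∙ v')   ≈⟨ assoc u u' (v ∙ v') ⟩
      u ∙ (u' ∙ (v ∙ v'))   ≈⟨ ∙-congˡ (sym (assoc u' v v')) ⟩
      u ∙ ((u' ∙ v) ∙ v')   ≈⟨ ∙-congˡ (∙-congʳ (comm u' v)) ⟩
      u ∙ ((v ∙ u') ∙ v')   ≈⟨ ∙-congˡ (assoc v u' v') ⟩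
      u ∙ (v ∙ (u' ∙ v'))   ≈⟨ sym (assoc u v (u' ∙ v')) ⟩
      (u ∙ v) ∙ (u' ∙ v')   ≈⟨ ∙-cong uv uv' ⟩
      ε ∙ ε                 ≈⟨ identityˡ ε ⟩
      ε                     ∎
    eq : x ≈ (u ∙ u') ∙ z
    eq = begin
      x               ≈⟨ x≈uy ⟩
      u ∙ y           ≈⟨ ∙-congˡ y≈u'z ⟩
      u ∙ (u' ∙ z)    ≈⟨ sym (assoc u u' z) ⟩
      (u ∙ u') ∙ z    ∎

  -- the atoms of H_red: atoms of H up to associates
  AtomSetoid : Setoid (c ⊔ ℓ) (c ⊔ ℓ)
  AtomSetoid = record
    { Carrier = Atom
    ; _≈_ = λ p q → proj₁ p ≃ proj₁ q
    ; isEquivalence = record { refl = ≃-refl ; sym = ≃-sym ; trans = ≃-trans }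
    }

  -- Factorizations: elements of the free abelian monoid Z(H) on the atoms
  -- of H_red, represented by lists of atoms; two lists represent the same
  -- factorization iff they are permutations of each other up to associates.
  Fz : Set (c ⊔ ℓ)
  Fz = List Atom

  open PermSetoid AtomSetoid using (_↭_) public

  _≋_ : Fz → Fz → Set (c ⊔ ℓ)
  z ≋ z' = z ↭ z'

  ∣_∣ : Fz → ℕ
  ∣ z ∣ = length z

  -- π_H (up to units: we compute the product in H)
  π : Fz → Carrier
  π = foldr (λ p acc → proj₁ p ∙ acc) ε

  Atomic : Set (c ⊔ ℓ)
  Atomic = ∀ x → ¬ IsUnit x → ∃[ z ] (π z ≈ x)

  _∣Z_ : Fz → Fz → Set (c ⊔ ℓ)
  g ∣Z z = ∃[ w ] (z ≋ (g ++ w))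

  IsGcd : Fz → Fz → Fz → Set (c ⊔ ℓ)
  IsGcd z z' g = g ∣Z z × g ∣Z z' × (∀ h → h ∣Z z → h ∣Z z' → h ∣Z g)

  GcdOne : Fz → Fz → Set (c ⊔ ℓ)
  GcdOne z z' = IsGcd z z' []

  Dist : Fz → Fz → ℕ → Set (c ⊔ ℓ)
  Dist z z' n = ∃[ g ] (IsGcd z z' g × n ≡ ((∣ z ∣ ∸ ∣ g ∣) ⊔ℕ (∣ z' ∣ ∸ ∣ g ∣)))

  DistLe : Fz → Fz → ℕ → Set (c ⊔ ℓ)
  DistLe z z' N = ∃[ n ] (Dist z z' n × n ≤ N)

  module _ (a : Carrier) where

    InZ : Fz → Set (c ⊔ ℓ)
    InZ z = π z ≃ a

    InZk : ℕ → Fz → Set (c ⊔ ℓ)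
    InZk k z = InZ z × ∣ z ∣ ≡ k

    InL : ℕ → Set (c ⊔ ℓ)
    InL k = ∃[ z ] InZk k z

    Adjacent : ℕ → ℕ → Set (c ⊔ ℓ)
    Adjacent k l = InL k × InL l × k < l × (∀ m → InL m → k < m → m < l → ⊥)

    -- d(Z_k(a), Z_l(a)) = n   (a minimum; used only for k, l ∈ L(a))
    DistSet : ℕ → ℕ → ℕ → Set (c ⊔ ℓ)
    DistSet k l n =
      (∃[ x ] ∃[ y ] (InZk k x × InZk l y × Dist x y n)) ×
      (∀ x y m → InZk k x → InZk l y → Dist x y m → n ≤ m)

    data Chain (R : Fz → Fz → Set (c ⊔ ℓ)) : Fz → Fz → Set (c ⊔ ℓ) where
      step : ∀ {z z'} → InZ z → InZ z' → R z z' → Chain R z z'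
      _∷ᶜ_ : ∀ {z w z'} → (InZ z × R z w) → Chain R w z' → Chain R z z'

    MonNStep : ℕ → Fz → Fz → Set (c ⊔ ℓ)
    MonNStep N z z' = DistLe z z' N × ∣ z ∣ ≤ ∣ z' ∣

    RStep : Fz → Fz → Set (c ⊔ ℓ)
    RStep z z' = ¬ GcdOne z z'

    MonRStep : Fz → Fz → Set (c ⊔ ℓ)
    MonRStep z z' = RStep z z' × ∣ z ∣ ≤ ∣ z' ∣

    EqRStep : Fz → Fz → Set (c ⊔ ℓ)
    EqRStep z z' = RStep z z' × ∣ z ∣ ≡ ∣ z' ∣

    -- "a monotone chain concatenating z and z'": it may run from z to z'
    -- or from z' to z (monotonicity fixes the direction when lengths differ)
    MonNConcat : ℕ → Fz → Fz → Set (c ⊔ ℓ)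
    MonNConcat N z z' = Chain (MonNStep N) z z' ⊎ Chain (MonNStep N) z' z

    MonRConcat : Fz → Fz → Set (c ⊔ ℓ)
    MonRConcat z z' = Chain MonRStep z z' ⊎ Chain MonRStep z' z

    RRel : Fz → Fz → Set (c ⊔ ℓ)
    RRel z z' = Chain RStep z z'

    EqRel : Fz → Fz → Set (c ⊔ ℓ)
    EqRel z z' = Chain EqRStep z z'

    -- c_mon(a) = N  (N ∈ ℕ; c_mon(a) = ∞ iff there is no such N)
    AllMonN : ℕ → Set (c ⊔ ℓ)
    AllMonN N = ∀ z z' → InZ z → InZ z' → MonNConcat N z z'

    IsCmon : ℕ → Set (c ⊔ ℓ)
    IsCmon N = AllMonN N × (∀ M → AllMonN M → N ≤ M)

    MuAdjSet : ℕ → Set (c ⊔ ℓ)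
    MuAdjSet k = InL k × ∃[ l ] (Adjacent l k × DistSet k l k)

    -- μ_adj(a) = m  for m ∈ ℕ (sup in ℕ ∪ {∞}, sup ∅ = 0)
    IsMuAdj : ℕ → Set (c ⊔ ℓ)
    IsMuAdj m = (∀ k → MuAdjSet k → k ≤ m) × (∀ m' → (∀ k → MuAdjSet k → k ≤ m') → m ≤ m')

-- In the free commutative monoid of factorizations, gcd(x,y) = 1 exactly when
-- d(x,y) = max(|x|,|y|), since a gcd g lowers the distance to max(|x|,|y|) ∸ |g|;
-- this gives (2). A monotone N-chain that starts above N = c_mon(a) only visits
-- factorizations longer than N, so consecutive members are at distance ≤ N and
-- cannot be coprime: it is already a monotone R-chain, giving (1). For (3), a
-- monotone R-chain from length k to the adjacent length l must step directly
-- from Z_k(a) to Z_l(a) through a non-coprime pair, so d(Z_l(a), Z_k(a)) < l by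
-- (2); as k is the only length adjacent below l, l does not belong to the set
-- whose supremum is μ_adj(a), and a supremum l > 0 of a set of naturals is attained.
module Submission where

open import Defs
open import Level using (Level)
open import Algebra.Bundles using (CommutativeMonoid)
open import Data.Nat using (ℕ; suc; _<_; _≤_; _∸_; _≟_; s≤s; z≤n) renaming (_⊔_ to _⊔ℕ_)
open import Data.Nat.Properties
open import Data.Product using (Σ; ∃-syntax; _×_; _,_; proj₁; proj₂)
open import Data.Sum using (_⊎_; inj₁; inj₂)
open import Data.Empty using (⊥-elim)
open import Data.List using (List; []; _∷_; _++_; length)
open import Data.List.Properties using (length-++-≤ˡ)
open import Data.List.Relation.Unary.Any using (here)
open import Function.Bundles using (_⇔_; mk⇔)
open import Relation.Nullary using (¬_; yes; no)
open import Relation.Nullary.Decidable using (¬¬-excluded-middle)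
open import Relation.Binary.PropositionalEquality using (_≡_; refl; cong; cong₂; subst; subst₂)
  renaming (sym to ≡-sym; trans to ≡-trans)
open import Relation.Binary.Bundles using (Setoid)
open import Relation.Binary.Definitions using (tri<; tri≈; tri>)
import Data.List.Membership.Setoid as Membership
import Data.List.Membership.Setoid.Properties as MembershipProperties
import Data.List.Relation.Binary.Permutation.Setoid as Permutation
import Data.List.Relation.Binary.Permutation.Setoid.Properties as PermutationProperties

module FreeCommutativeMonoid {a ℓ : Level} (S : Setoid a ℓ) where
  open Setoid S using () renaming (Carrier to A; refl to ≈-refl; sym to ≈-sym)
  open Membership S using (_∈_; _∉_)
  open MembershipProperties using (∈-∃++; ∈-++⁻; ∈-++⁺ˡ)
  open Permutation S using (_↭_; ↭-reflexive-≋; ↭-refl; ↭-sym; ↭-trans; ↭-prep)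
  open PermutationProperties S using (∈-resp-↭; xs↭ys⇒|xs|≡|ys|; shift; drop-∷; ↭-shift; ++⁺ˡ; ++⁺ʳ)

  infix 4 _∣_

  _∣_ : List A → List A → Set (a Level.⊔ ℓ)
  g ∣ z = ∃[ w ] (z ↭ (g ++ w))

  IsGcd : List A → List A → List A → Set (a Level.⊔ ℓ)
  IsGcd z z' g = g ∣ z × g ∣ z' × (∀ h → h ∣ z → h ∣ z' → h ∣ g)

  []-∣ : ∀ z → [] ∣ z
  []-∣ z = z , ↭-refl

  IsGcd-sym : ∀ {z z' g} → IsGcd z z' g → IsGcd z' z g
  IsGcd-sym (g∣z , g∣z' , greatest) = g∣z' , g∣z , λ h h∣z' h∣z → greatest h h∣z h∣z'

  ∣⇒length≤ : ∀ {g z} → g ∣ z → length g ≤ length z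
  ∣⇒length≤ {g} (w , z↭gw) = subst (length g ≤_) (≡-sym (xs↭ys⇒|xs|≡|ys| z↭gw)) (length-++-≤ˡ g)

  ∣-respʳ-↭ : ∀ {h z z'} → z ↭ z' → h ∣ z → h ∣ z'
  ∣-respʳ-↭ z↭z' (w , z↭hw) = w , ↭-trans (↭-sym z↭z') z↭hw

  ∣-respˡ-↭ : ∀ {h h' z} → h ↭ h' → h ∣ z → h' ∣ z
  ∣-respˡ-↭ h↭h' (w , z↭hw) = w , ↭-trans z↭hw (++⁺ʳ w h↭h')

  ∣-there : ∀ {h z} p → h ∣ z → h ∣ p ∷ z
  ∣-there {h} p (w , z↭hw) = p ∷ w , ↭-trans (↭-prep p z↭hw) (↭-sym (↭-shift h w))

  ∣-prep : ∀ {h z} p → h ∣ z → p ∷ h ∣ p ∷ z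
  ∣-prep p (w , z↭hw) = w , ↭-prep p z↭hw

  ∣-cancel-∷ : ∀ {h z} p → p ∷ h ∣ p ∷ z → h ∣ z
  ∣-cancel-∷ p (w , pz↭phw) = w , drop-∷ pz↭phw

  ∈-resp-∣ : ∀ {p h z} → p ∈ h → h ∣ z → p ∈ z
  ∈-resp-∣ p∈h (w , z↭hw) = ∈-resp-↭ (↭-sym z↭hw) (∈-++⁺ˡ S p∈h)

  ∈⇒↭∷ : ∀ {p z} → p ∈ z → ∃[ z' ] (z ↭ p ∷ z')
  ∈⇒↭∷ p∈z with ∈-∃++ S p∈z
  ... | ys , zs , w , p≈w , z≋ = ys ++ zs , ↭-trans (↭-reflexive-≋ z≋) (shift (≈-sym p≈w) ys zs)

  ∣-∷⁻ : ∀ {h z} p → h ∣ p ∷ z → (∃[ h' ] (h ↭ p ∷ h' × h' ∣ z)) ⊎ h ∣ z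
  ∣-∷⁻ {h} p (w , pz↭hw) with ∈-++⁻ S h (∈-resp-↭ pz↭hw (here ≈-refl))
  ... | inj₁ p∈h with ∈⇒↭∷ p∈h
  ...   | h' , h↭ph' = inj₁ (h' , h↭ph' , w , drop-∷ (↭-trans pz↭hw (++⁺ʳ w h↭ph')))
  ∣-∷⁻ {h} p (w , pz↭hw) | inj₂ p∈w with ∈⇒↭∷ p∈w
  ...   | w' , w↭pw' = inj₂ (w' , drop-∷ (↭-trans pz↭hw (↭-trans (++⁺ˡ h w↭pw') (↭-shift h w'))))

  IsGcd-∷-common : ∀ {p x y y' g} → y ↭ p ∷ y' → IsGcd x y' g → IsGcd (p ∷ x) y (p ∷ g)
  IsGcd-∷-common {p} {x} {y} {g = g} y↭py' (g∣x , g∣y' , greatest) =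
    ∣-prep p g∣x , ∣-respʳ-↭ (↭-sym y↭py') (∣-prep p g∣y') , divides-pg
    where
    divides-pg : ∀ h → h ∣ p ∷ x → h ∣ y → h ∣ p ∷ g
    divides-pg h h∣px h∣y with ∣-∷⁻ p h∣px | ∣-∷⁻ p (∣-respʳ-↭ y↭py' h∣y)
    ... | inj₁ (h' , h↭ph' , h'∣x) | _ =
      ∣-respˡ-↭ (↭-sym h↭ph') (∣-prep p (greatest h' h'∣x
        (∣-cancel-∷ p (∣-respˡ-↭ h↭ph' (∣-respʳ-↭ y↭py' h∣y)))))
    ... | inj₂ _ | inj₁ (h' , h↭ph' , h'∣y') =
      ∣-respˡ-↭ (↭-sym h↭ph') (∣-prep p (greatest h' (∣-cancel-∷ p (∣-respˡ-↭ h↭ph' h∣px)) h'∣y'))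
    ... | inj₂ h∣x | inj₂ h∣y' = ∣-there p (greatest h h∣x h∣y')

  IsGcd-∷-absent : ∀ {p x y g} → p ∉ y → IsGcd x y g → IsGcd (p ∷ x) y g
  IsGcd-∷-absent {p} {x} {y} {g} p∉y (g∣x , g∣y , greatest) = ∣-there p g∣x , g∣y , divides-g
    where
    divides-g : ∀ h → h ∣ p ∷ x → h ∣ y → h ∣ g
    divides-g h h∣px h∣y with ∣-∷⁻ p h∣px
    ... | inj₁ (h' , h↭ph' , _) = ⊥-elim (p∉y (∈-resp-∣ (∈-resp-↭ (↭-sym h↭ph') (here ≈-refl)) h∣y))
    ... | inj₂ h∣x = greatest h h∣x h∣y

  -- Excluded middle is only needed for the membership p ∈ y, so a gcd exists up to double negation.
  ¬¬-gcd : ∀ x y → ¬ ¬ Σ (List A) (IsGcd x y)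
  ¬¬-gcd [] y k = k ([] , []-∣ [] , []-∣ y , λ h h∣[] _ → h∣[])
  ¬¬-gcd (p ∷ x) y k = ¬¬-excluded-middle λ
    { (yes p∈y) → let (y' , y↭py') = ∈⇒↭∷ p∈y in
        ¬¬-gcd x y' λ (g , G) → k (p ∷ g , IsGcd-∷-common y↭py' G)
    ; (no p∉y) → ¬¬-gcd x y λ (g , G) → k (g , IsGcd-∷-absent p∉y G) }

lub-attained : ∀ {p} {P : ℕ → Set p} {m} → (∀ k → P k → k ≤ m) →
               (∀ m' → (∀ k → P k → k ≤ m') → m ≤ m') → 0 < m → ¬ ¬ P m
lub-attained {P = P} {m = suc m} upper least _ ¬Pm = 1+n≰n (least m below-m)
  where
  below-m : ∀ k → P k → k ≤ m
  below-m k Pk = <⇒≤pred (≤∧≢⇒< (upper k Pk) (λ k≡m → ¬Pm (subst P k≡m Pk)))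

module Factorizations {c ℓ : Level} (H : CommutativeMonoid c ℓ) where
  open CommutativeMonoid H using (Carrier)
  open Fact H
  open FreeCommutativeMonoid AtomSetoid using ([]-∣; IsGcd-sym; ∣⇒length≤; ¬¬-gcd)

  GcdOne-sym : ∀ {x y} → GcdOne x y → GcdOne y x
  GcdOne-sym = IsGcd-sym

  Dist-coprime-unique : ∀ {x y m} → GcdOne x y → Dist x y m → m ≡ ∣ x ∣ ⊔ℕ ∣ y ∣
  Dist-coprime-unique {x} {y} (_ , _ , greatest) (g , (g∣x , g∣y , _) , m≡) =
    ≡-trans m≡ (cong (λ t → (∣ x ∣ ∸ t) ⊔ℕ (∣ y ∣ ∸ t)) (n≤0⇒n≡0 (∣⇒length≤ (greatest g g∣x g∣y))))

  Dist-coprime : ∀ {x y} → GcdOne x y → Dist x y (∣ x ∣ ⊔ℕ ∣ y ∣)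
  Dist-coprime x⊥y = [] , x⊥y , refl

  maximal-Dist⇒coprime : ∀ {x y} → (∀ m → Dist x y m → ∣ x ∣ ⊔ℕ ∣ y ∣ ≤ m) → GcdOne x y
  maximal-Dist⇒coprime {x} {y} maximal = []-∣ x , []-∣ y , only-trivial
    where
    only-trivial : ∀ h → h ∣Z x → h ∣Z y → h ∣Z []
    only-trivial [] _ _ = []-∣ []
    only-trivial (p ∷ h) h∣x h∣y = ⊥-elim (¬¬-gcd x y no-proper-gcd)
      where
      no-proper-gcd : ¬ Σ Fz (IsGcd x y)
      no-proper-gcd (g , G@(g∣x , _ , greatest)) = <⇒≱ (∸-monoʳ-< 0<∣g∣ ∣g∣≤max) max≤max∸∣g∣
        where
        0<∣g∣ : 0 < ∣ g ∣
        0<∣g∣ = ≤-trans (s≤s z≤n) (∣⇒length≤ (greatest (p ∷ h) h∣x h∣y))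
        ∣g∣≤max : ∣ g ∣ ≤ ∣ x ∣ ⊔ℕ ∣ y ∣
        ∣g∣≤max = ≤-trans (∣⇒length≤ g∣x) (m≤m⊔n (∣ x ∣) (∣ y ∣))
        max≤max∸∣g∣ : ∣ x ∣ ⊔ℕ ∣ y ∣ ≤ (∣ x ∣ ⊔ℕ ∣ y ∣) ∸ ∣ g ∣
        max≤max∸∣g∣ = subst (∣ x ∣ ⊔ℕ ∣ y ∣ ≤_) (≡-sym (∸-distribʳ-⊔ (∣ g ∣) (∣ x ∣) (∣ y ∣)))
                        (maximal _ (g , G , refl))

  DistLe⇒¬coprime : ∀ {z z' N} → DistLe z z' N → N < ∣ z ∣ → ¬ GcdOne z z'
  DistLe⇒¬coprime {z} {z'} (n , d , n≤N) N<∣z∣ z⊥z' =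
    <⇒≱ N<∣z∣ (≤-trans (m≤m⊔n (∣ z ∣) (∣ z' ∣))
                       (≤-trans (≤-reflexive (≡-sym (Dist-coprime-unique z⊥z' d))) n≤N))

  module _ (a : Carrier) where

    Chain-start : ∀ {R z z'} → Chain a R z z' → InZ a z
    Chain-start (step z∈ _ _) = z∈
    Chain-start ((z∈ , _) ∷ᶜ _) = z∈

    Chain-map : ∀ {R R'} → (∀ {u v} → R u v → R' u v) → ∀ {x y} → Chain a R x y → Chain a R' x y
    Chain-map f (step x∈ y∈ r) = step x∈ y∈ (f r)
    Chain-map f ((x∈ , r) ∷ᶜ ch) = (x∈ , f r) ∷ᶜ Chain-map f ch

    infixr 5 _++ᶜ_

    _++ᶜ_ : ∀ {R x y z} → Chain a R x y → Chain a R y z → Chain a R x z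
    step x∈ _ r ++ᶜ ch' = (x∈ , r) ∷ᶜ ch'
    ((x∈ , r) ∷ᶜ ch) ++ᶜ ch' = (x∈ , r) ∷ᶜ (ch ++ᶜ ch')

    Chain-reverse : ∀ {R} → (∀ {u v} → R u v → R v u) → ∀ {x y} → Chain a R x y → Chain a R y x
    Chain-reverse sym (step x∈ y∈ r) = step y∈ x∈ (sym r)
    Chain-reverse sym ((x∈ , r) ∷ᶜ ch) = Chain-reverse sym ch ++ᶜ step (Chain-start ch) x∈ (sym r)

    Chain-length-≤ : ∀ {R} → (∀ {u v} → R u v → ∣ u ∣ ≤ ∣ v ∣) → ∀ {x y} → Chain a R x y → ∣ x ∣ ≤ ∣ y ∣
    Chain-length-≤ mono (step _ _ r) = mono r
    Chain-length-≤ mono ((_ , r) ∷ᶜ ch) = ≤-trans (mono r) (Chain-length-≤ mono ch)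

    RStep-sym : ∀ {u v} → RStep a u v → RStep a v u
    RStep-sym ¬u⊥v v⊥u = ¬u⊥v (GcdOne-sym v⊥u)

    EqRStep-sym : ∀ {u v} → EqRStep a u v → EqRStep a v u
    EqRStep-sym (r , ∣u∣≡∣v∣) = RStep-sym r , ≡-sym ∣u∣≡∣v∣

    MonRChain-length-≤ : ∀ {x y} → Chain a (MonRStep a) x y → ∣ x ∣ ≤ ∣ y ∣
    MonRChain-length-≤ = Chain-length-≤ proj₂

    MonRChain⇒EqRChain : ∀ {x y} → Chain a (MonRStep a) x y → ∣ x ∣ ≡ ∣ y ∣ → Chain a (EqRStep a) x y
    MonRChain⇒EqRChain (step x∈ y∈ (r , _)) ∣x∣≡∣y∣ = step x∈ y∈ (r , ∣x∣≡∣y∣)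
    MonRChain⇒EqRChain {x} (_∷ᶜ_ {w = w} (x∈ , (r , ∣x∣≤∣w∣)) ch) ∣x∣≡∣y∣ =
      (x∈ , (r , ∣x∣≡∣w∣)) ∷ᶜ MonRChain⇒EqRChain ch (≡-trans (≡-sym ∣x∣≡∣w∣) ∣x∣≡∣y∣)
      where
      ∣x∣≡∣w∣ : ∣ x ∣ ≡ ∣ w ∣
      ∣x∣≡∣w∣ = ≤-antisym ∣x∣≤∣w∣ (≤-trans (MonRChain-length-≤ ch) (≤-reflexive (≡-sym ∣x∣≡∣y∣)))

    MonNChain⇒MonRChain : ∀ {N x y} → N < ∣ x ∣ → Chain a (MonNStep a N) x y → Chain a (MonRStep a) x y
    MonNChain⇒MonRChain N<∣x∣ (step x∈ y∈ (d≤N , ∣x∣≤∣y∣)) =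
      step x∈ y∈ (DistLe⇒¬coprime d≤N N<∣x∣ , ∣x∣≤∣y∣)
    MonNChain⇒MonRChain N<∣x∣ ((x∈ , (d≤N , ∣x∣≤∣w∣)) ∷ᶜ ch) =
      (x∈ , (DistLe⇒¬coprime d≤N N<∣x∣ , ∣x∣≤∣w∣)) ∷ᶜ MonNChain⇒MonRChain (<-≤-trans N<∣x∣ ∣x∣≤∣w∣) ch

    AllMonN⇒MonRConcat : ∀ {N x y} → AllMonN a N → InZ a x → InZ a y → N < ∣ x ∣ → N < ∣ y ∣ →
                         MonRConcat a x y
    AllMonN⇒MonRConcat {x = x} {y} allMonN x∈ y∈ N<∣x∣ N<∣y∣ with allMonN x y x∈ y∈
    ... | inj₁ ch = inj₁ (MonNChain⇒MonRChain N<∣x∣ ch)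
    ... | inj₂ ch = inj₂ (MonNChain⇒MonRChain N<∣y∣ ch)

    MonRConcat⇒RRel : ∀ {x y} → MonRConcat a x y → RRel a x y
    MonRConcat⇒RRel (inj₁ ch) = Chain-map proj₁ ch
    MonRConcat⇒RRel (inj₂ ch) = Chain-reverse RStep-sym (Chain-map proj₁ ch)

    MonRConcat⇒EqRel : ∀ {x y} → MonRConcat a x y → ∣ x ∣ ≡ ∣ y ∣ → EqRel a x y
    MonRConcat⇒EqRel (inj₁ ch) ∣x∣≡∣y∣ = MonRChain⇒EqRChain ch ∣x∣≡∣y∣
    MonRConcat⇒EqRel (inj₂ ch) ∣x∣≡∣y∣ = Chain-reverse EqRStep-sym (MonRChain⇒EqRChain ch (≡-sym ∣x∣≡∣y∣))

    MonRConcat-upward : ∀ {x y} → ∣ x ∣ < ∣ y ∣ → MonRConcat a x y → Chain a (MonRStep a) x y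
    MonRConcat-upward _ (inj₁ ch) = ch
    MonRConcat-upward ∣x∣<∣y∣ (inj₂ ch) = ⊥-elim (<⇒≱ ∣x∣<∣y∣ (MonRChain-length-≤ ch))

    DistSet-max⇒coprime : ∀ {k l} → DistSet a k l (k ⊔ℕ l) →
                           ∀ x y → InZk a k x → InZk a l y → GcdOne x y
    DistSet-max⇒coprime (_ , minimal) x y x∈@(_ , refl) y∈@(_ , refl) =
      maximal-Dist⇒coprime λ m d → minimal x y m x∈ y∈ d

    coprime⇒DistSet-max : ∀ {k l} → InL a k → InL a l →
                           (∀ x y → InZk a k x → InZk a l y → GcdOne x y) → DistSet a k l (k ⊔ℕ l)
    coprime⇒DistSet-max (x , x∈@(_ , refl)) (y , y∈@(_ , refl)) coprime =
      (x , y , x∈ , y∈ , Dist-coprime (coprime x y x∈ y∈)) ,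
      λ x' y' m x'∈ y'∈ d → ≤-reflexive (≡-sym (≡-trans (Dist-coprime-unique (coprime x' y' x'∈ y'∈) d)
                                                     (cong₂ _⊔ℕ_ (proj₂ x'∈) (proj₂ y'∈))))

    DistSet-max⇔coprime : ∀ {k l} → InL a k → InL a l →
      DistSet a k l (k ⊔ℕ l) ⇔ (∀ x y → InZk a k x → InZk a l y → GcdOne x y)
    DistSet-max⇔coprime k∈ l∈ = mk⇔ DistSet-max⇒coprime (coprime⇒DistSet-max k∈ l∈)

    Adjacent-unique : ∀ {k k' l} → Adjacent a k l → Adjacent a k' l → k ≡ k'
    Adjacent-unique {k} {k'} (k∈ , _ , k<l , gap) (k'∈ , _ , k'<l , gap') with <-cmp k k'
    ... | tri< k<k' _ _ = ⊥-elim (gap _ k'∈ k<k' k'<l)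
    ... | tri≈ _ k≡k' _ = k≡k'
    ... | tri> _ _ k'<k = ⊥-elim (gap' _ k∈ k'<k k<l)

    MonRChain-crosses : ∀ {k l x y} → Adjacent a k l → Chain a (MonRStep a) x y → ∣ x ∣ ≡ k → ∣ y ∣ ≡ l →
                        ∃[ u ] ∃[ v ] (InZk a k u × InZk a l v × RStep a u v)
    MonRChain-crosses _ (step x∈ y∈ (r , _)) ∣x∣≡k ∣y∣≡l = _ , _ , (x∈ , ∣x∣≡k) , (y∈ , ∣y∣≡l) , r
    MonRChain-crosses {k} {l} adj@(_ , _ , _ , gap) (_∷ᶜ_ {w = w} (x∈ , (r , ∣x∣≤∣w∣)) ch) ∣x∣≡k ∣y∣≡l
      with ∣ w ∣ ≟ k
    ... | yes ∣w∣≡k = MonRChain-crosses adj ch ∣w∣≡k ∣y∣≡l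
    ... | no ∣w∣≢k with <-cmp ∣ w ∣ l
    ...   | tri≈ _ ∣w∣≡l _ = _ , _ , (x∈ , ∣x∣≡k) , (Chain-start ch , ∣w∣≡l) , r
    ...   | tri< ∣w∣<l _ _ = ⊥-elim (gap _ (w , Chain-start ch , refl) k<∣w∣ ∣w∣<l)
      where
      k<∣w∣ : k < ∣ w ∣
      k<∣w∣ = ≤∧≢⇒< (subst (_≤ ∣ w ∣) ∣x∣≡k ∣x∣≤∣w∣) (λ k≡∣w∣ → ∣w∣≢k (≡-sym k≡∣w∣))
    ...   | tri> _ _ l<∣w∣ = ⊥-elim (<⇒≱ l<∣w∣ (subst (∣ w ∣ ≤_) ∣y∣≡l (MonRChain-length-≤ ch)))

    MonRConcat-adjacent⇒crossing : ∀ {k l} → Adjacent a k l →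
      (∃[ x ] ∃[ y ] (InZk a k x × InZk a l y × MonRConcat a x y)) →
      ∃[ u ] ∃[ v ] (InZk a k u × InZk a l v × RStep a u v)
    MonRConcat-adjacent⇒crossing {k} {l} adj@(_ , _ , k<l , _) (x , y , (_ , ∣x∣≡k) , (_ , ∣y∣≡l) , x≈y) =
      MonRChain-crosses adj (MonRConcat-upward ∣x∣<∣y∣ x≈y) ∣x∣≡k ∣y∣≡l
      where
      ∣x∣<∣y∣ : ∣ x ∣ < ∣ y ∣
      ∣x∣<∣y∣ = subst₂ _<_ (≡-sym ∣x∣≡k) (≡-sym ∣y∣≡l) k<l

    MonRConcat-adjacent⇒¬MuAdjSet : ∀ {k l} → Adjacent a k l →
      (∃[ x ] ∃[ y ] (InZk a k x × InZk a l y × MonRConcat a x y)) → ¬ MuAdjSet a l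
    MonRConcat-adjacent⇒¬MuAdjSet {k} {l} adj@(_ , _ , k<l , _) chain (_ , k' , adj' , dist)
      with Adjacent-unique adj adj' | MonRConcat-adjacent⇒crossing adj chain
    ... | refl | u , v , u∈ , v∈ , ¬u⊥v = ¬u⊥v (GcdOne-sym (DistSet-max⇒coprime dist-max v u v∈ u∈))
      where
      dist-max : DistSet a l k (l ⊔ℕ k)
      dist-max = subst (DistSet a l k) (≡-sym (m≥n⇒m⊔n≡m (<⇒≤ k<l))) dist

    MonRConcat-adjacent⇒¬IsMuAdj : ∀ {k l} → Adjacent a k l →
      (∃[ x ] ∃[ y ] (InZk a k x × InZk a l y × MonRConcat a x y)) → ¬ IsMuAdj a l
    MonRConcat-adjacent⇒¬IsMuAdj adj@(_ , _ , k<l , _) chain (upper , least) =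
      lub-attained upper least (≤-<-trans z≤n k<l) (MonRConcat-adjacent⇒¬MuAdjSet adj chain)

lemma3p3 : {c ℓ : Level} (H : CommutativeMonoid c ℓ) →
    let open CommutativeMonoid H using (Carrier) in
    let open Fact H in
    Cancellative → Atomic → (a : Carrier) →
    (∀ (x y : Fz) (N : ℕ) → InZ a x → InZ a y → IsCmon a N → N < ∣ x ∣ → N < ∣ y ∣ →
    MonRConcat a x y × RRel a x y × (∣ x ∣ ≡ ∣ y ∣ → EqRel a x y))
    × (∀ (k l : ℕ) → InL a k → InL a l →
    (DistSet a k l (k ⊔ℕ l) ⇔ (∀ (x y : Fz) → InZk a k x → InZk a l y → GcdOne x y)))
    × (∀ (k l : ℕ) → Adjacent a k l →
    (∃[ x ] ∃[ y ] (InZk a k x × InZk a l y × MonRConcat a x y)) →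
    ¬ IsMuAdj a l)
lemma3p3 H _ _ a =
  (λ x y N x∈ y∈ (allMonN , _) N<∣x∣ N<∣y∣ →
    let x≈y = AllMonN⇒MonRConcat a allMonN x∈ y∈ N<∣x∣ N<∣y∣
    in x≈y , MonRConcat⇒RRel a x≈y , MonRConcat⇒EqRel a x≈y) ,
  (λ k l k∈ l∈ → DistSet-max⇔coprime a k∈ l∈) ,
  (λ k l → MonRConcat-adjacent⇒¬IsMuAdj a)
  where open Factorizations H
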